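{- Let $k$ be a field, $n\ge 2$, and let $A_1,\ldots,A_n\in k[t]$ be coprime monic polynomials with $1\notin\{A_1,\ldots,A_n\}$, and suppose $\operatorname{char}(k)=0$ or $\operatorname{char}(k)>n$. Let $a_i=\deg A_i$ and let $d$ be a positive integer with $d\ge\min_i a_i$. Identify the space $\mathcal{P}_d$ of polynomials of degree $\le d$ with $k^{d+1}$ via coefficient vectors. Then $$\mathcal{F}_d=\bigcup_{T\in\mathcal{T}_d}(\mathcal{V}_T+B_T).$$ In particular, $\mathcal{F}_d$ is a union of finitely many affine subspaces of $\mathcal{P}_d$.
   Context: $k[t]_{\geq 0}$ denotes the set of monic polynomials in $k[t]$ together with $0$; $\deg 0=-\infty$. $\mathcal{M}_d$ is the set of monic polynomials of degree $d$, and $\mathcal{F}_d\subseteq\mathcal{M}_d$ is the set of monic $F$ of degree $d$ for which $x_1A_1+\cdots+x_nA_n=F$ has a solution with all $x_i\in k[t]_{\geq0}$. $\mathcal{T}_d$ is the set of $n$-tuples $T=(e_1,\ldots,e_n)$ (entries integers or $-\infty$) such that (1) there is a unique index $j$ with $e_j=d-a_j\ge 0$, and (2) for $i\neq j$, either $e_i=-\infty$ or $e_i$ is an integer with $0\le e_i<d-a_i$. For such $T$ let $\mathcal{R}_T=\{i: 0<e_i\le d-a_i\}$ and $\mathcal{S}_T=\{i: e_i=0\}$. If $\mathcal{R}_T=\emptyset$, set $\mathcal{V}_T=\{0\}$ and $B_T=\sum_{i\in\mathcal{S}_T}A_i$. Otherwise let $\mathcal{V}_T$ be the $k$-linear span of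 the polynomials $t^mA_i$ for $i\in\mathcal{R}_T$ and $0\le m\le e_i-1$ (equivalently the column space of the matrix $A_T$ whose columns are the coefficient vectors of these polynomials), and $B_T=\sum_{i\in\mathcal{R}_T}t^{e_i}A_i+\sum_{i\in\mathcal{S}_T}A_i$ (empty sums are $0$). -}

module Defs where

open import Level using (Level; _⊔_; suc)
open import Algebra.Bundles using (CommutativeRing)
open import Data.Nat as ℕ using (ℕ; zero; _<_; _≤_; _∸_)
import Data.Nat
open import Data.Fin using (Fin; toℕ)
import Data.Fin as Fin
open import Data.Vec using (Vec; lookup)
open import Data.Maybe using (Maybe; just; nothing)
open import Data.Product using (Σ; ∃; _×_; _,_)
open import Data.Sum using (_⊎_)
open import Relation.Nullary using (¬_; yes; no)
open import Relation.Binary.PropositionalEquality using (_≡_; _≢_)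

record Field (c ℓ : Level) : Set (Level.suc (c ⊔ ℓ)) where
  field
    commutativeRing : CommutativeRing c ℓ
  open CommutativeRing commutativeRing public
  field
    1≉0     : ¬ (1# ≈ 0#)
    inverse : ∀ x → ¬ (x ≈ 0#) → Σ Carrier (λ y → x * y ≈ 1#)

module Polys {c ℓ : Level} (K : Field c ℓ) where
  open Field K

  natMul : ℕ → Carrier
  natMul zero        = 0#
  natMul (ℕ.suc m)   = 1# + natMul m

  CharZeroOrGreater : ℕ → Set ℓ
  CharZeroOrGreater n = ∀ m → 1 ≤ m → m ≤ n → ¬ (natMul m ≈ 0#)

  -- A polynomial in k[t] is represented by its coefficient function
  -- (coefficient of t^m); all polynomials below are built from finite
  -- data (lists/vectors), hence have finite support.
  Poly : Set c
  Poly = ℕ → Carrier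

  _≈ₚ_ : Poly → Poly → Set ℓ
  p ≈ₚ q = ∀ m → p m ≈ q m

  0ₚ : Poly
  0ₚ _ = 0#

  1ₚ : Poly
  1ₚ zero      = 1#
  1ₚ (ℕ.suc _) = 0#

  _+ₚ_ : Poly → Poly → Poly
  (p +ₚ q) m = p m + q m

  sumBelow : ℕ → (ℕ → Carrier) → Carrier
  sumBelow zero      f = 0#
  sumBelow (ℕ.suc m) f = sumBelow m f + f m

  _*ₚ_ : Poly → Poly → Poly
  (p *ₚ q) m = sumBelow (ℕ.suc m) (λ j → p j * q (m ∸ j))

  _·ₚ_ : Carrier → Poly → Poly
  (a ·ₚ p) m = a * p m

  shift : ℕ → Poly → Poly
  shift e p m with m Data.Nat.<? e
  ... | yes _ = 0#
  ... | no  _ = p (m ∸ e)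

  sumFin : ∀ {n} → (Fin n → Poly) → Poly
  sumFin {zero}    f = 0ₚ
  sumFin {ℕ.suc n} f = f Fin.zero +ₚ sumFin (λ i → f (Fin.suc i))

  sumRange : ℕ → (ℕ → Poly) → Poly
  sumRange zero      f = 0ₚ
  sumRange (ℕ.suc e) f = sumRange e f +ₚ f e

  fromVec : ∀ {l} → Vec Carrier l → Poly
  fromVec {l} v m with m Data.Nat.<? l
  ... | yes m<l = lookup v (Fin.fromℕ< m<l)
  ... | no  _   = 0#

  record FinPoly : Set c where
    constructor finPoly
    field
      len   : ℕ
      coeffs : Vec Carrier len
  toPoly : FinPoly → Poly
  toPoly (finPoly _ v) = fromVec v

  monic : ∀ {a} → Vec Carrier a → Poly
  monic {a} v = fromVec v +ₚ shift a 1ₚ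

  DegPos : Poly → Set ℓ
  DegPos p = ∃ λ m → 1 ≤ m × ¬ (p m ≈ 0#)

  _∣ₚ_ : Poly → Poly → Set (c ⊔ ℓ)
  D ∣ₚ A = Σ FinPoly λ Q → (toPoly Q *ₚ D) ≈ₚ A

  Coprime : ∀ {n} → (Fin n → Poly) → Set (c ⊔ ℓ)
  Coprime A = ¬ (Σ FinPoly λ D → DegPos (toPoly D) × (∀ i → toPoly D ∣ₚ A i))

  -- an element of k[t]_{≥0}: either 0 (nothing) or a monic polynomial
  MonicOrZero : Set c
  MonicOrZero = Maybe (Σ ℕ λ e → Vec Carrier e)

  toPolyM : MonicOrZero → Poly
  toPolyM nothing          = 0ₚ
  toPolyM (just (_ , v))   = monic v

  module Setting (n : ℕ) (a : Fin n → ℕ) (Acoef : (i : Fin n) → Vec Carrier (a i)) where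

    A : Fin n → Poly
    A i = monic (Acoef i)

    Pd : ℕ → Set c
    Pd d = Vec Carrier (ℕ.suc d)

    InF : (d : ℕ) → Pd d → Set (c ⊔ ℓ)
    InF d F = (lookup F (Fin.fromℕ d) ≈ 1#)
            × Σ (Fin n → MonicOrZero) λ x →
                sumFin (λ i → toPolyM (x i) *ₚ A i) ≈ₚ fromVec F

    -- tuples with entries in ℕ ∪ {-∞}  (nothing = -∞)
    Tuple : Set
    Tuple = Fin n → Maybe ℕ

    InT : ℕ → Tuple → Set
    InT d T = Σ (Fin n) λ j →
        ((a j ≤ d × T j ≡ just (d ∸ a j))
         × (∀ j' → a j' ≤ d → T j' ≡ just (d ∸ a j') → j' ≡ j))
      × (∀ i → i ≢ j → (T i ≡ nothing) ⊎ (Σ ℕ λ e → T i ≡ just e × e ℕ.+ a i < d))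

    -- contribution of index i to an element of 𝓥_T + B_T, with
    -- coefficients c_m (m < e_i) for the spanning vectors t^m A_i:
    --   i ∈ R_T (e_i > 0):  t^{e_i} A_i + Σ_{m<e_i} c_m t^m A_i
    --   i ∈ S_T (e_i = 0):  A_i
    --   e_i = -∞       :  0
    contrib : Maybe ℕ → (ℕ → Carrier) → Poly → Poly
    contrib nothing            cs Ai = 0ₚ
    contrib (just zero)        cs Ai = Ai
    contrib (just (ℕ.suc e'))  cs Ai =
      shift (ℕ.suc e') Ai +ₚ sumRange (ℕ.suc e') (λ m → cs m ·ₚ shift m Ai)

    -- F ∈ 𝓥_T + B_T, where 𝓥_T = span{ t^m A_i : i ∈ R_T, m < e_i }
    -- (= {0} if R_T = ∅) and B_T = Σ_{R_T} t^{e_i} A_i + Σ_{S_T} A_i.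
    InVB : (d : ℕ) → Tuple → Pd d → Set (c ⊔ ℓ)
    InVB d T F = Σ (Fin n → ℕ → Carrier) λ cs →
      sumFin (λ i → contrib (T i) (cs i) (A i)) ≈ₚ fromVec F

-- Write xᵢ = t^{eᵢ} + Σ_{m<eᵢ} cₘ t^m; then xᵢAᵢ = t^{eᵢ}Aᵢ + Σ_{m<eᵢ} cₘ t^m Aᵢ is exactly the
-- i-th summand of an element of 𝓥_T + B_T with T = (eᵢ), and it is monic of degree eᵢ + aᵢ
-- (or 0 when xᵢ = 0).  In a degree m bounding all deg(xᵢAᵢ), the coefficient of Σ xᵢAᵢ is
-- therefore the number of indices with deg(xᵢAᵢ) = m, times 1.  This number lies in [0, n],
-- so since char k is 0 or exceeds n it vanishes in k only when the number is 0, and equals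
-- 1 only when the number is 1.  Hence Σ xᵢAᵢ is monic of degree d exactly when every
-- deg(xᵢAᵢ) is at most d and exactly one of them equals d, which is the condition T ∈ 𝓣_d.
module Submission where

open import Defs
open import Level using (Level)
import Algebra.Properties.AbelianGroup as AbelianGroupProperties
import Algebra.Properties.CommutativeSemigroup as CommutativeSemigroupProperties
open import Data.Fin as Fin using (Fin; toℕ; fromℕ<; fromℕ)
import Data.Fin.Properties as Fin
open import Data.Maybe as Maybe using (Maybe; just; nothing)
open import Data.Maybe.Properties using (≡-dec)
open import Data.Maybe.Relation.Unary.All as All using (All; just; nothing)
open import Data.Nat as ℕ using (ℕ; zero; suc; _∸_; _≤_; _<_; _≤?_; _<?_; z≤n; s≤s)
import Data.Nat.Properties as ℕ
open import Data.Product using (Σ; ∃; ∃!; _×_; _,_; proj₁; proj₂; uncurry)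
open import Data.Sum using (_⊎_; inj₁; inj₂)
open import Data.Vec using (Vec; lookup; tabulate)
open import Data.Vec.Properties using (lookup∘tabulate)
open import Function.Base using (_∘_)
open import Function.Bundles using (_⇔_; mk⇔; Equivalence)
open import Relation.Binary.Definitions using (DecidableEquality; tri<; tri≈; tri>)
open import Relation.Binary.PropositionalEquality as ≡ using (_≡_; _≢_)
import Relation.Binary.Reasoning.Setoid as SetoidReasoning
open import Relation.Nullary using (¬_; yes; no; contradiction)

_≟ₘ_ : DecidableEquality (Maybe ℕ)
_≟ₘ_ = ≡-dec ℕ._≟_

m+n<o⇒n<o∸m : ∀ m {n o} → m ℕ.+ n < o → n < o ∸ m
m+n<o⇒n<o∸m m {n} {o} m+n<o = ℕ.m+n≤o⇒m≤o∸n (suc n) (≡.subst (_< o) (ℕ.+-comm m n) m+n<o)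

module Counting where

  hits : ∀ {n} → (Fin n → Maybe ℕ) → ℕ → ℕ
  hits {zero}  δ m = 0
  hits {suc n} δ m with δ Fin.zero ≟ₘ just m
  ... | yes _ = suc (hits (δ ∘ Fin.suc) m)
  ... | no  _ = hits (δ ∘ Fin.suc) m

  hits-≤ : ∀ {n} (δ : Fin n → Maybe ℕ) m → hits δ m ≤ n
  hits-≤ {zero}  δ m = z≤n
  hits-≤ {suc n} δ m with δ Fin.zero ≟ₘ just m
  ... | yes _ = s≤s (hits-≤ (δ ∘ Fin.suc) m)
  ... | no  _ = ℕ.m≤n⇒m≤1+n (hits-≤ (δ ∘ Fin.suc) m)

  hits≡0⇒≢ : ∀ {n} {δ : Fin n → Maybe ℕ} {m} → hits δ m ≡ 0 → ∀ i → δ i ≢ just m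
  hits≡0⇒≢ {suc n} {δ} {m} h i with δ Fin.zero ≟ₘ just m
  hits≡0⇒≢ {suc n} {δ} {m} () i          | yes _
  hits≡0⇒≢ {suc n} {δ} {m} h  Fin.zero    | no miss = miss
  hits≡0⇒≢ {suc n} {δ} {m} h  (Fin.suc i) | no _    = hits≡0⇒≢ h i

  ≢⇒hits≡0 : ∀ {n} {δ : Fin n → Maybe ℕ} {m} → (∀ i → δ i ≢ just m) → hits δ m ≡ 0
  ≢⇒hits≡0 {zero}          none = ≡.refl
  ≢⇒hits≡0 {suc n} {δ} {m} none with δ Fin.zero ≟ₘ just m
  ... | yes hit = contradiction hit (none Fin.zero)
  ... | no  _   = ≢⇒hits≡0 (none ∘ Fin.suc)

  hits≡1⇒∃! : ∀ {n} {δ : Fin n → Maybe ℕ} {m} → hits δ m ≡ 1 → ∃! _≡_ (λ j → δ j ≡ just m)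
  hits≡1⇒∃! {suc n} {δ} {m} h with δ Fin.zero ≟ₘ just m
  ... | yes hit = Fin.zero , hit , λ
    { {Fin.zero} _ → ≡.refl
    ; {Fin.suc j} hitʲ → contradiction hitʲ (hits≡0⇒≢ (ℕ.suc-injective h) j) }
  ... | no miss with hits≡1⇒∃! h
  ...   | j , hitʲ , unique = Fin.suc j , hitʲ , λ
    { {Fin.zero} hit → contradiction hit miss
    ; {Fin.suc j′} hitʲ′ → ≡.cong Fin.suc (unique hitʲ′) }

  ∃!⇒hits≡1 : ∀ {n} {δ : Fin n → Maybe ℕ} {m} → ∃! _≡_ (λ j → δ j ≡ just m) → hits δ m ≡ 1
  ∃!⇒hits≡1 {suc n} {δ} {m} (j , hitʲ , unique) with δ Fin.zero ≟ₘ just m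
  ... | yes hit = ≡.cong suc (≢⇒hits≡0 {δ = δ ∘ Fin.suc} λ i hitⁱ →
                    Fin.0≢1+n (≡.trans (≡.sym (unique hit)) (unique hitⁱ)))
  ∃!⇒hits≡1 {suc n} (Fin.zero  , hitʲ , unique) | no miss = contradiction hitʲ miss
  ∃!⇒hits≡1 {suc n} (Fin.suc j , hitʲ , unique) | no miss =
    ∃!⇒hits≡1 (j , hitʲ , λ hitⁱ → Fin.suc-injective (unique hitⁱ))

  bounded : ∀ {n} (δ : Fin n → Maybe ℕ) → ∃ λ B → ∀ i → All (_≤ B) (δ i)
  bounded {zero}  δ = 0 , λ ()
  bounded {suc n} δ with bounded (δ ∘ Fin.suc)
  ... | B , below = Maybe.fromMaybe 0 (δ Fin.zero) ℕ.⊔ B , λ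
    { Fin.zero → head (δ Fin.zero)
    ; (Fin.suc i) → All.map (λ D≤B → ℕ.≤-trans D≤B (ℕ.m≤n⊔m _ B)) (below i) }
    where
    head : ∀ o → All (_≤ Maybe.fromMaybe 0 o ℕ.⊔ B) o
    head nothing  = nothing
    head (just D) = just (ℕ.m≤m⊔n D B)

open Counting

module PolynomialArithmetic {c ℓ : Level} (K : Field c ℓ) where
  open Field K hiding (zero)
  open Polys K
  open SetoidReasoning setoid
  open AbelianGroupProperties +-abelianGroup using (identityʳ-unique)
  open CommutativeSemigroupProperties +-commutativeSemigroup using (interchange)

  shift-< : ∀ e p {m} → m < e → shift e p m ≈ 0#
  shift-< e p {m} m<e with m <? e
  ... | yes _   = refl
  ... | no  m≮e = contradiction m<e m≮e

  shift-≥ : ∀ e p {m} → e ≤ m → shift e p m ≈ p (m ∸ e)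
  shift-≥ e p {m} e≤m with m <? e
  ... | yes m<e = contradiction e≤m (ℕ.<⇒≱ m<e)
  ... | no  _   = refl

  fromVec-< : ∀ {l} (v : Vec Carrier l) {m} (m<l : m < l) → fromVec v m ≈ lookup v (fromℕ< m<l)
  fromVec-< {l} v {m} m<l with m <? l
  ... | yes _   = refl
  ... | no  m≮l = contradiction m<l m≮l

  fromVec-≥ : ∀ {l} (v : Vec Carrier l) {m} → l ≤ m → fromVec v m ≈ 0#
  fromVec-≥ {l} v {m} l≤m with m <? l
  ... | yes m<l = contradiction l≤m (ℕ.<⇒≱ m<l)
  ... | no  _   = refl

  sumBelow-cong : ∀ N {f g} → (∀ {j} → j < N → f j ≈ g j) → sumBelow N f ≈ sumBelow N g
  sumBelow-cong zero    f≈g = refl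
  sumBelow-cong (suc N) f≈g = +-cong (sumBelow-cong N (f≈g ∘ ℕ.m<n⇒m<1+n)) (f≈g ℕ.≤-refl)

  sumBelow-≈0 : ∀ N {f} → (∀ {j} → j < N → f j ≈ 0#) → sumBelow N f ≈ 0#
  sumBelow-≈0 zero    f≈0 = refl
  sumBelow-≈0 (suc N) f≈0 = trans (+-cong (sumBelow-≈0 N (f≈0 ∘ ℕ.m<n⇒m<1+n)) (f≈0 ℕ.≤-refl)) (+-identityʳ 0#)

  sumBelow-+ : ∀ N f g → sumBelow N (λ j → f j + g j) ≈ sumBelow N f + sumBelow N g
  sumBelow-+ zero    f g = sym (+-identityʳ 0#)
  sumBelow-+ (suc N) f g = trans (+-cong (sumBelow-+ N f g) refl) (interchange _ _ _ _)

  sumBelow-extend : ∀ {L} N {f} → L ≤ N → (∀ {j} → L ≤ j → j < N → f j ≈ 0#) →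
                    sumBelow N f ≈ sumBelow L f
  sumBelow-extend zero    z≤n  _   = refl
  sumBelow-extend (suc N) L≤1+N f≈0 with ℕ.m≤n⇒m<n∨m≡n L≤1+N
  ... | inj₂ ≡.refl     = refl
  ... | inj₁ (s≤s L≤N) = trans (+-cong (sumBelow-extend N L≤N (λ L≤j → f≈0 L≤j ∘ ℕ.m<n⇒m<1+n))
                                       (f≈0 L≤N ℕ.≤-refl))
                                (+-identityʳ _)

  sumBelow-single : ∀ N {f} k → k < N → (∀ {j} → j < N → j ≢ k → f j ≈ 0#) → sumBelow N f ≈ f k
  sumBelow-single N {f} k k<N f≈0 = begin
    sumBelow N f        ≈⟨ sumBelow-extend N k<N (λ k<j j<N → f≈0 j<N (ℕ.>⇒≢ k<j)) ⟩
    sumBelow k f + f k  ≈⟨ +-congʳ (sumBelow-≈0 k (λ j<k → f≈0 (ℕ.<-trans j<k k<N) (ℕ.<⇒≢ j<k))) ⟩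
    0# + f k            ≈⟨ +-identityˡ (f k) ⟩
    f k                 ∎

  sumRange-coeff : ∀ e (f : ℕ → Poly) k → sumRange e f k ≡ sumBelow e (λ m → f m k)
  sumRange-coeff zero    f k = ≡.refl
  sumRange-coeff (suc e) f k = ≡.cong (_+ f e k) (sumRange-coeff e f k)

  sumFin-cong : ∀ {n} {Q R : Fin n → Poly} → (∀ i → Q i ≈ₚ R i) → sumFin Q ≈ₚ sumFin R
  sumFin-cong {zero}  Q≈R m = refl
  sumFin-cong {suc n} Q≈R m = +-cong (Q≈R Fin.zero m) (sumFin-cong (Q≈R ∘ Fin.suc) m)

  0ₚ-*ₚ : ∀ r → (0ₚ *ₚ r) ≈ₚ 0ₚ
  0ₚ-*ₚ r m = sumBelow-≈0 (suc m) (λ _ → zeroˡ _)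

  *ₚ-distribʳ : ∀ p q r → ((p +ₚ q) *ₚ r) ≈ₚ ((p *ₚ r) +ₚ (q *ₚ r))
  *ₚ-distribʳ p q r m = trans (sumBelow-cong (suc m) (λ _ → distribʳ _ _ _)) (sumBelow-+ (suc m) _ _)

  monomial-≢ : ∀ e {m} → m ≢ e → shift e 1ₚ m ≈ 0#
  monomial-≢ e {m} m≢e with ℕ.<-cmp m e
  ... | tri< m<e _ _ = shift-< e 1ₚ m<e
  ... | tri≈ _ m≡e _ = contradiction m≡e m≢e
  ... | tri> _ _ e<m = trans (shift-≥ e 1ₚ (ℕ.<⇒≤ e<m)) (1ₚ-positive (ℕ.m<n⇒0<n∸m e<m))
    where
    1ₚ-positive : ∀ {k} → 0 < k → 1ₚ k ≈ 0#
    1ₚ-positive {suc _} _ = refl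

  monomial-≡ : ∀ e → shift e 1ₚ e ≈ 1#
  monomial-≡ e = trans (shift-≥ e 1ₚ ℕ.≤-refl) (reflexive (≡.cong 1ₚ (ℕ.n∸n≡0 e)))

  monomial-*ₚ : ∀ e r → (shift e 1ₚ *ₚ r) ≈ₚ shift e r
  monomial-*ₚ e r m with e ≤? m
  ... | yes e≤m = begin
    (shift e 1ₚ *ₚ r) m       ≈⟨ sumBelow-single (suc m) e (s≤s e≤m)
                                   (λ _ j≢e → trans (*-congʳ (monomial-≢ e j≢e)) (zeroˡ _)) ⟩
    shift e 1ₚ e * r (m ∸ e)  ≈⟨ trans (*-congʳ (monomial-≡ e)) (*-identityˡ _) ⟩
    r (m ∸ e)                 ≈⟨ shift-≥ e r e≤m ⟨
    shift e r m               ∎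
  ... | no e≰m = trans (sumBelow-≈0 (suc m) (λ j≤m → trans (*-congʳ (shift-< e 1ₚ (ℕ.≤-<-trans (ℕ.s≤s⁻¹ j≤m) m<e))) (zeroˡ _)))
                       (sym (shift-< e r m<e))
    where
    m<e : m < e
    m<e = ℕ.≰⇒> e≰m

  shiftCombination : ℕ → (ℕ → Carrier) → Poly → Poly
  shiftCombination e cs r = sumRange e (λ m → cs m ·ₚ shift m r)

  fromVec-*ₚ : ∀ {e} (v : Vec Carrier e) r → (fromVec v *ₚ r) ≈ₚ shiftCombination e (fromVec v) r
  fromVec-*ₚ {e} v r k = begin
    sumBelow (suc k) (λ j → fromVec v j * r (k ∸ j))
      ≈⟨ sumBelow-cong (suc k) (λ j≤k → *-congˡ (shift-≥ _ r (ℕ.s≤s⁻¹ j≤k))) ⟨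
    sumBelow (suc k) h
      ≈⟨ sumBelow-extend (suc k ℕ.+ e) (ℕ.m≤m+n (suc k) e) (λ k<j _ → trans (*-congˡ (shift-< _ r k<j)) (zeroʳ _)) ⟨
    sumBelow (suc k ℕ.+ e) h
      ≈⟨ sumBelow-extend (suc k ℕ.+ e) (ℕ.m≤n+m e (suc k)) (λ e≤j _ → trans (*-congʳ (fromVec-≥ v e≤j)) (zeroˡ _)) ⟩
    sumBelow e h
      ≡⟨ sumRange-coeff e (λ m → fromVec v m ·ₚ shift m r) k ⟨
    shiftCombination e (fromVec v) r k ∎
    where
    h : ℕ → Carrier
    h j = fromVec v j * shift j r k

  monic-*ₚ : ∀ {e} (v : Vec Carrier e) r → (monic v *ₚ r) ≈ₚ (shift e r +ₚ shiftCombination e (fromVec v) r)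
  monic-*ₚ {e} v r k = begin
    (monic v *ₚ r) k                                          ≈⟨ *ₚ-distribʳ (fromVec v) (shift e 1ₚ) r k ⟩
    (fromVec v *ₚ r) k + (shift e 1ₚ *ₚ r) k                  ≈⟨ +-cong (fromVec-*ₚ v r k) (monomial-*ₚ e r k) ⟩
    shiftCombination e (fromVec v) r k + shift e r k          ≈⟨ +-comm _ _ ⟩
    shift e r k + shiftCombination e (fromVec v) r k          ∎

  VanishesAbove : ℕ → Poly → Set ℓ
  VanishesAbove D p = ∀ {m} → D < m → p m ≈ 0#

  -- The degree nothing stands for deg 0 = -∞.
  MonicOfDegree : Poly → Maybe ℕ → Set ℓ
  MonicOfDegree p nothing  = p ≈ₚ 0ₚ
  MonicOfDegree p (just D) = p D ≈ 1# × VanishesAbove D p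

  monic-monicOfDegree : ∀ {e} (v : Vec Carrier e) → MonicOfDegree (monic v) (just e)
  monic-monicOfDegree {e} v =
    trans (+-cong (fromVec-≥ v ℕ.≤-refl) (monomial-≡ e)) (+-identityˡ 1#) ,
    λ e<m → trans (+-cong (fromVec-≥ v (ℕ.<⇒≤ e<m)) (monomial-≢ e (ℕ.>⇒≢ e<m))) (+-identityʳ 0#)

  shiftCombination-vanishes : ∀ {b} e cs B → VanishesAbove b B →
                              ∀ {k} → e ℕ.+ b ≤ k → shiftCombination e cs B k ≈ 0#
  shiftCombination-vanishes {b} e cs B B-vanishes {k} e+b≤k =
    trans (reflexive (sumRange-coeff e _ k)) (sumBelow-≈0 e term≈0)
    where
    term≈0 : ∀ {m} → m < e → cs m * shift m B k ≈ 0#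
    term≈0 {m} m<e =
      trans (*-congˡ (trans (shift-≥ m B (ℕ.m+n≤o⇒m≤o m (ℕ.<⇒≤ m+b<k))) (B-vanishes (m+n<o⇒n<o∸m m m+b<k))))
            (zeroʳ _)
      where
      m+b<k : m ℕ.+ b < k
      m+b<k = ℕ.<-≤-trans (ℕ.+-monoˡ-< b m<e) e+b≤k

  shifted-monicOfDegree : ∀ {b} e cs B → MonicOfDegree B (just b) →
                          MonicOfDegree (shift e B +ₚ shiftCombination e cs B) (just (e ℕ.+ b))
  shifted-monicOfDegree {b} e cs B (B-leading , B-vanishes) = leading , vanishes
    where
    leading : shift e B (e ℕ.+ b) + shiftCombination e cs B (e ℕ.+ b) ≈ 1#
    leading = begin
      shift e B (e ℕ.+ b) + shiftCombination e cs B (e ℕ.+ b)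
        ≈⟨ +-cong (shift-≥ e B (ℕ.m≤m+n e b)) (shiftCombination-vanishes e cs B B-vanishes ℕ.≤-refl) ⟩
      B (e ℕ.+ b ∸ e) + 0#  ≡⟨ ≡.cong (λ k → B k + 0#) (ℕ.m+n∸m≡n e b) ⟩
      B b + 0#              ≈⟨ +-identityʳ _ ⟩
      B b                   ≈⟨ B-leading ⟩
      1#                    ∎
    vanishes : VanishesAbove (e ℕ.+ b) (shift e B +ₚ shiftCombination e cs B)
    vanishes {k} e+b<k =
      trans (+-cong (trans (shift-≥ e B (ℕ.m+n≤o⇒m≤o e (ℕ.<⇒≤ e+b<k))) (B-vanishes (m+n<o⇒n<o∸m e e+b<k)))
                    (shiftCombination-vanishes e cs B B-vanishes (ℕ.<⇒≤ e+b<k)))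
            (+-identityʳ 0#)

  monicOfDegree-leading : ∀ {p o m} → MonicOfDegree p o → o ≡ just m → p m ≈ 1#
  monicOfDegree-leading (leading , _) ≡.refl = leading

  monicOfDegree-≢ : ∀ {p} o {m} → MonicOfDegree p o → All (_≤ m) o → o ≢ just m → p m ≈ 0#
  monicOfDegree-≢ nothing  p≈0              _           _   = p≈0 _
  monicOfDegree-≢ (just D) (_ , vanishes) (just D≤m) D≢m = vanishes (ℕ.≤∧≢⇒< D≤m (D≢m ∘ ≡.cong just))

  sumFin-coeff : ∀ {n} {Q : Fin n → Poly} {δ : Fin n → Maybe ℕ} {m} →
                 (∀ i → MonicOfDegree (Q i) (δ i)) → (∀ i → All (_≤ m) (δ i)) →
                 sumFin Q m ≈ natMul (hits δ m)
  sumFin-coeff {zero}              _   _     = refl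
  sumFin-coeff {suc n} {Q} {δ} {m} deg below with δ Fin.zero ≟ₘ just m
  ... | yes hit  = +-cong (monicOfDegree-leading (deg Fin.zero) hit) (sumFin-coeff (deg ∘ Fin.suc) (below ∘ Fin.suc))
  ... | no  miss = trans (+-cong (monicOfDegree-≢ (δ Fin.zero) (deg Fin.zero) (below Fin.zero) miss)
                                (sumFin-coeff (deg ∘ Fin.suc) (below ∘ Fin.suc)))
                         (+-identityˡ _)

  module _ {n} (char : CharZeroOrGreater n) where

    natMul≈0⇒≡0 : ∀ {k} → k ≤ n → natMul k ≈ 0# → k ≡ 0
    natMul≈0⇒≡0 {zero}  _   _  = ≡.refl
    natMul≈0⇒≡0 {suc k} k≤n k≈0 = contradiction k≈0 (char (suc k) (s≤s z≤n) k≤n)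

    natMul≈1⇒≡1 : ∀ {k} → k ≤ n → natMul k ≈ 1# → k ≡ 1
    natMul≈1⇒≡1 {zero}        _   0≈1 = contradiction (sym 0≈1) 1≉0
    natMul≈1⇒≡1 {suc zero}    _   _   = ≡.refl
    natMul≈1⇒≡1 {suc (suc k)} k≤n k≈1 =
      contradiction (identityʳ-unique 1# _ k≈1) (char (suc k) (s≤s z≤n) (ℕ.≤-trans (ℕ.n≤1+n _) k≤n))

    module _ {Q : Fin n → Poly} {δ : Fin n → Maybe ℕ} (deg : ∀ i → MonicOfDegree (Q i) (δ i)) where

      degrees-≤ : ∀ {d} → VanishesAbove d (sumFin Q) → ∀ i → All (_≤ d) (δ i)
      degrees-≤ {d} vanishes = lower (proj₁ (bounded δ)) (proj₂ (bounded δ))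
        where
        lower : ∀ B → (∀ i → All (_≤ B) (δ i)) → ∀ i → All (_≤ d) (δ i)
        lower zero    below i = All.map (λ D≤0 → ℕ.≤-trans D≤0 z≤n) (below i)
        lower (suc B) below with suc B ≤? d
        ... | yes B<d = λ i → All.map (λ D≤B → ℕ.≤-trans D≤B B<d) (below i)
        ... | no  B≮d = lower B λ i → All-≤-pred (below i) (hits≡0⇒≢ noneAtTop i)
          where
          noneAtTop : hits δ (suc B) ≡ 0
          noneAtTop = natMul≈0⇒≡0 (hits-≤ δ (suc B)) (trans (sym (sumFin-coeff deg below)) (vanishes (ℕ.≰⇒> B≮d)))
          All-≤-pred : ∀ {o} → All (_≤ suc B) o → o ≢ just (suc B) → All (_≤ B) o
          All-≤-pred nothing   _    = nothing
          All-≤-pred (just D≤) D≢ = just (ℕ.s≤s⁻¹ (ℕ.≤∧≢⇒< D≤ (D≢ ∘ ≡.cong just)))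

      leading-unique : ∀ {d} → (∀ i → All (_≤ d) (δ i)) → sumFin Q d ≈ 1# → ∃! _≡_ (λ j → δ j ≡ just d)
      leading-unique {d} below leading =
        hits≡1⇒∃! (natMul≈1⇒≡1 (hits-≤ δ d) (trans (sym (sumFin-coeff deg below)) leading))

module Decomposition {c ℓ : Level} (K : Field c ℓ) (n : ℕ) (a : Fin n → ℕ)
                     (Acoef : (i : Fin n) → Vec (Field.Carrier K) (a i)) where
  open Field K hiding (zero)
  open Polys K
  open Setting n a Acoef
  open PolynomialArithmetic K
  open SetoidReasoning setoid

  exponent : MonicOrZero → Maybe ℕ
  exponent nothing        = nothing
  exponent (just (e , _)) = just e

  lowerCoeffs : MonicOrZero → ℕ → Carrier
  lowerCoeffs nothing        _ = 0#
  lowerCoeffs (just (_ , v))   = fromVec v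

  fromExponent : Maybe ℕ → (ℕ → Carrier) → MonicOrZero
  fromExponent nothing  cs = nothing
  fromExponent (just e) cs = just (e , tabulate (cs ∘ toℕ))

  toPolyM-*ₚ : ∀ x B → (toPolyM x *ₚ B) ≈ₚ contrib (exponent x) (lowerCoeffs x) B
  toPolyM-*ₚ nothing            B   = 0ₚ-*ₚ B
  toPolyM-*ₚ (just (zero , v))  B m = trans (monic-*ₚ v B m) (trans (+-identityʳ _) (shift-≥ 0 B z≤n))
  toPolyM-*ₚ (just (suc e , v)) B   = monic-*ₚ v B

  contrib-cong : ∀ e {cs cs′} B → (∀ {m} → m < e → cs m ≈ cs′ m) → contrib (just e) cs B ≈ₚ contrib (just e) cs′ B
  contrib-cong zero    B cs≈cs′ m = refl
  contrib-cong (suc e) B cs≈cs′ m =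
    +-congˡ (trans (reflexive (sumRange-coeff (suc e) _ m))
                   (trans (sumBelow-cong (suc e) (λ k<e → *-congʳ (cs≈cs′ k<e)))
                          (reflexive (≡.sym (sumRange-coeff (suc e) _ m)))))

  fromExponent-*ₚ : ∀ o cs B → (toPolyM (fromExponent o cs) *ₚ B) ≈ₚ contrib o cs B
  fromExponent-*ₚ nothing  cs B   = 0ₚ-*ₚ B
  fromExponent-*ₚ (just e) cs B m =
    trans (toPolyM-*ₚ (fromExponent (just e) cs) B m) (contrib-cong e B fromVec-tabulate m)
    where
    fromVec-tabulate : ∀ {k} → k < e → fromVec (tabulate {n = e} (cs ∘ toℕ)) k ≈ cs k
    fromVec-tabulate k<e = trans (fromVec-< _ k<e)
      (reflexive (≡.trans (lookup∘tabulate (cs ∘ toℕ) (fromℕ< k<e)) (≡.cong cs (Fin.toℕ-fromℕ< k<e))))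

  solutions⇔ : ∀ G →
    (Σ (Fin n → MonicOrZero) λ x → sumFin (λ i → toPolyM (x i) *ₚ A i) ≈ₚ G) ⇔
    (Σ Tuple λ T → Σ (Fin n → ℕ → Carrier) λ cs → sumFin (λ i → contrib (T i) (cs i) (A i)) ≈ₚ G)
  solutions⇔ G = mk⇔
    (λ (x , eq) → exponent ∘ x , lowerCoeffs ∘ x ,
                   λ m → trans (sumFin-cong (λ i k → sym (toPolyM-*ₚ (x i) (A i) k)) m) (eq m))
    (λ (T , cs , eq) → (λ i → fromExponent (T i) (cs i)) ,
                        λ m → trans (sumFin-cong (λ i → fromExponent-*ₚ (T i) (cs i) (A i)) m) (eq m))

  contrib-monicOfDegree : ∀ {b} B → MonicOfDegree B (just b) →
                          ∀ o cs → MonicOfDegree (contrib o cs B) (Maybe.map (ℕ._+ b) o)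
  contrib-monicOfDegree B deg nothing        cs _ = refl
  contrib-monicOfDegree B deg (just zero)    cs   = deg
  contrib-monicOfDegree B deg (just (suc e)) cs   = shifted-monicOfDegree (suc e) cs B deg

  degrees : Tuple → Fin n → Maybe ℕ
  degrees T i = Maybe.map (ℕ._+ a i) (T i)

  summand-monicOfDegree : ∀ T (cs : Fin n → ℕ → Carrier) i → MonicOfDegree (contrib (T i) (cs i) (A i)) (degrees T i)
  summand-monicOfDegree T cs i = contrib-monicOfDegree (A i) (monic-monicOfDegree (Acoef i)) (T i) (cs i)

  map-+≡just⇒ : ∀ {b d} o → Maybe.map (ℕ._+ b) o ≡ just d → b ≤ d × o ≡ just (d ∸ b)
  map-+≡just⇒ {b} (just e) ≡.refl = ℕ.m≤n+m b e , ≡.cong just (≡.sym (ℕ.m+n∸n≡m e b))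

  ⇒map-+≡just : ∀ {b d} o → b ≤ d → o ≡ just (d ∸ b) → Maybe.map (ℕ._+ b) o ≡ just d
  ⇒map-+≡just _ b≤d ≡.refl = ≡.cong just (ℕ.m∸n+n≡m b≤d)

  below-⇔-other : ∀ {b d} o →
    (o ≡ nothing ⊎ Σ ℕ λ e → o ≡ just e × e ℕ.+ b < d) ⇔
    (All (_≤ d) (Maybe.map (ℕ._+ b) o) × Maybe.map (ℕ._+ b) o ≢ just d)
  below-⇔-other nothing  = mk⇔ (λ _ → nothing , λ ()) (λ _ → inj₁ ≡.refl)
  below-⇔-other (just e) = mk⇔
    (λ { (inj₂ (_ , ≡.refl , e+b<d)) → just (ℕ.<⇒≤ e+b<d) , λ { ≡.refl → ℕ.<-irrefl ≡.refl e+b<d } })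
    (λ { (just e+b≤d , ≢d) → inj₂ (e , ≡.refl , ℕ.≤∧≢⇒< e+b≤d (≢d ∘ ≡.cong just)) })

  InT⇒ : ∀ {d T} → InT d T → (∀ i → All (_≤ d) (degrees T i)) × ∃! _≡_ (λ j → degrees T j ≡ just d)
  InT⇒ {d} {T} (j , ((aⱼ≤d , Tⱼ) , unique) , others) = below , j , topⱼ , onlyⱼ
    where
    topⱼ : degrees T j ≡ just d
    topⱼ = ⇒map-+≡just (T j) aⱼ≤d Tⱼ
    onlyⱼ : ∀ {i} → degrees T i ≡ just d → j ≡ i
    onlyⱼ {i} topᵢ = ≡.sym (uncurry (unique i) (map-+≡just⇒ (T i) topᵢ))
    below : ∀ i → All (_≤ d) (degrees T i)
    below i with i Fin.≟ j
    ... | yes ≡.refl = ≡.subst (All (_≤ d)) (≡.sym topⱼ) (just ℕ.≤-refl)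
    ... | no  i≢j    = proj₁ (Equivalence.to (below-⇔-other (T i)) (others i i≢j))

  ⇒InT : ∀ {d T} → (∀ i → All (_≤ d) (degrees T i)) → ∃! _≡_ (λ j → degrees T j ≡ just d) → InT d T
  ⇒InT {d} {T} below (j , topⱼ , onlyⱼ) =
    j , (map-+≡just⇒ (T j) topⱼ , λ i aᵢ≤d Tᵢ → ≡.sym (onlyⱼ (⇒map-+≡just (T i) aᵢ≤d Tᵢ))) ,
    λ i i≢j → Equivalence.from (below-⇔-other (T i)) (below i , λ topᵢ → i≢j (≡.sym (onlyⱼ topᵢ)))

  fromVec-last : ∀ d (F : Pd d) → fromVec F d ≈ lookup F (fromℕ d)
  fromVec-last d F = trans (fromVec-< F ℕ.≤-refl) (reflexive (≡.cong (lookup F) (≡.sym (Fin.fromℕ-def d))))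

  InF⇒ : CharZeroOrGreater n → ∀ {d F} → InF d F → Σ Tuple λ T → InT d T × InVB d T F
  InF⇒ char {d} {F} (F-monic , solution) with Equivalence.to (solutions⇔ (fromVec F)) solution
  ... | T , cs , eq = T , ⇒InT below (leading-unique char deg below leading) , cs , eq
    where
    deg : ∀ i → MonicOfDegree (contrib (T i) (cs i) (A i)) (degrees T i)
    deg = summand-monicOfDegree T cs
    below : ∀ i → All (_≤ d) (degrees T i)
    below = degrees-≤ char deg (λ d<m → trans (eq _) (fromVec-≥ F d<m))
    leading : sumFin (λ i → contrib (T i) (cs i) (A i)) d ≈ 1#
    leading = trans (eq d) (trans (fromVec-last d F) F-monic)

  ⇒InF : ∀ {d F} → (Σ Tuple λ T → InT d T × InVB d T F) → InF d F
  ⇒InF {d} {F} (T , inT , cs , eq) = F-monic , Equivalence.from (solutions⇔ (fromVec F)) (T , cs , eq)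
    where
    F-monic : lookup F (fromℕ d) ≈ 1#
    F-monic = begin
      lookup F (fromℕ d)                             ≈⟨ fromVec-last d F ⟨
      fromVec F d                                    ≈⟨ eq d ⟨
      sumFin (λ i → contrib (T i) (cs i) (A i)) d    ≈⟨ sumFin-coeff (summand-monicOfDegree T cs) (proj₁ (InT⇒ inT)) ⟩
      natMul (hits (degrees T) d)                    ≡⟨ ≡.cong natMul (∃!⇒hits≡1 (proj₂ (InT⇒ inT))) ⟩
      1# + 0#                                        ≈⟨ +-identityʳ 1# ⟩
      1#                                             ∎

theorem6p5 : {c ℓ : Level} (K : Field c ℓ) →
    let open Field K in
    let open Polys K in
    (n : ℕ) → 2 ≤ n →
    (a : Fin n → ℕ) (Acoef : (i : Fin n) → Vec Carrier (a i)) →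
    let open Setting n a Acoef in
    Coprime A →
    (∀ i → ¬ (A i ≈ₚ 1ₚ)) →
    CharZeroOrGreater n →
    (d : ℕ) → 1 ≤ d → (Σ (Fin n) λ i → a i ≤ d) →
    (F : Pd d) →
    InF d F ⇔ (Σ Tuple λ T → InT d T × InVB d T F)
theorem6p5 K n _ a Acoef _ _ char d _ _ F = mk⇔ (InF⇒ char) ⇒InF
  where open Decomposition K n a Acoef
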